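{- $\mathrm{EquSLP}\le_{\mathrm{P}}\mathrm{2SoSSLP}$ (polynomial-time many-one reducibility).
   Context: A (division-free, constant-free) straight-line program (SLP) representing an integer is a sequence $(b_0,\dots,b_m)$ with $b_0=1$ and $b_i=b_j\circ_i b_k$ for $j,k<i$, $\circ_i\in\{+,-,\times\}$; it represents $N=b_m$. $\mathrm{EquSLP}$: given an SLP representing $N\in\mathbb{Z}$, decide whether $N=0$. $\mathrm{2SoSSLP}$: given an SLP representing $N\in\mathbb{Z}$, decide whether $N$ is a sum of squares of two integers. -}

module Defs where

open import Data.Nat using (ℕ; zero; suc; _≤_; _≡ᵇ_; _*_; _+_; _^_)
open import Data.Integer as ℤ using (ℤ)
open import Data.Bool using (Bool; true; false; if_then_else_)
open import Data.Fin using (Fin; zero; suc)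
open import Data.List using (List; []; _∷_; _++_; replicate; length; concatMap)
open import Data.Product using (Σ; ∃; ∃-syntax; _×_; _,_)
open import Data.Unit using (⊤)
open import Relation.Binary.PropositionalEquality using (_≡_)
open import Function.Bundles using (_⇔_)

-- Straight-line programs
-- An SLP (b_0,...,b_m) with b_0 = 1 is given by its list of instructions
-- for b_1,...,b_m; the instruction for b_i is (∘_i , j , k) meaning
-- b_i = b_j ∘_i b_k, with j,k < i (well-formedness, see WF).

data Op : Set where
  add sub mul : Op

Instr : Set
Instr = Op × ℕ × ℕ

SLP : Set
SLP = List Instr

-- WF i P : the instructions of P define b_{i+1}, b_{i+2}, ... and only
-- refer to earlier entries.
WF : ℕ → SLP → Set
WF i [] = ⊤
WF i ((o , j , k) ∷ P) = j ≤ i × k ≤ i × WF (suc i) P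

applyOp : Op → ℤ → ℤ → ℤ
applyOp add x y = x ℤ.+ y
applyOp sub x y = x ℤ.- y
applyOp mul x y = x ℤ.* y

extend : (ℕ → ℤ) → ℕ → ℤ → (ℕ → ℤ)
extend env n v m = if m ≡ᵇ n then v else env m

-- env holds b_0..b_i ; result is the last entry b_m
evalFrom : (ℕ → ℤ) → ℕ → SLP → ℤ
evalFrom env i [] = env i
evalFrom env i ((o , j , k) ∷ P) =
  evalFrom (extend env (suc i) (applyOp o (env j) (env k))) (suc i) P

value : SLP → ℤ
value P = evalFrom (λ _ → ℤ.1ℤ) 0 P

-- Binary encoding of SLPs (prefix-free; indices in unary, which is
-- polynomially equivalent to binary since indices are < m)

encNat : ℕ → List Bool
encNat n = replicate n true ++ (false ∷ [])

encOp : Op → List Bool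
encOp add = false ∷ false ∷ []
encOp sub = false ∷ true ∷ []
encOp mul = true ∷ false ∷ []

encInstr : Instr → List Bool
encInstr (o , j , k) = encOp o ++ encNat j ++ encNat k

encSLP : SLP → List Bool
encSLP = concatMap encInstr

Language : Set₁
Language = List Bool → Set

EquSLP : Language
EquSLP w = Σ SLP λ P → WF 0 P × encSLP P ≡ w × value P ≡ ℤ.0ℤ

IsSumOfTwoSquares : ℤ → Set
IsSumOfTwoSquares N = ∃[ a ] ∃[ b ] N ≡ a ℤ.* a ℤ.+ b ℤ.* b

TwoSoSSLP : Language
TwoSoSSLP w = Σ SLP λ P → WF 0 P × encSLP P ≡ w × IsSumOfTwoSquares (value P)

-- Deterministic single-tape Turing machines (one-way infinite tape)
-- Tape alphabet Fin (3 + extra): zero = blank, 1 = bit 0, 2 = bit 1.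

data Move : Set where
  L R S : Move

record TM : Set where
  field
    nstates : ℕ
    extra   : ℕ
    start   : Fin nstates
    halting : Fin nstates → Bool
    δ       : Fin nstates → Fin (3 + extra) → Fin nstates × Fin (3 + extra) × Move

module _ (M : TM) where
  open TM M

  Γ : Set
  Γ = Fin (3 + extra)

  blank : Γ
  blank = zero

  bitSym : Bool → Γ
  bitSym false = suc zero
  bitSym true  = suc (suc zero)

  -- state, left part (nearest cell first), scanned symbol, right part
  record Config : Set where
    constructor cfg
    field
      state : Fin nstates
      left  : List Γ
      head  : Γ
      right : List Γ

  initConfig : List Bool → Config
  initConfig []      = cfg start [] blank []
  initConfig (b ∷ w) = cfg start [] (bitSym b) (Data.List.map bitSym w)

  moveHead : Move → List Γ → Γ → List Γ → List Γ × Γ × List Γ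
  moveHead S l h r = l , h , r
  moveHead L [] h r = [] , h , r
  moveHead L (x ∷ l) h r = l , x , h ∷ r
  moveHead R l h [] = h ∷ l , blank , []
  moveHead R l h (x ∷ r) = h ∷ l , x , r

  step : Config → Config
  step c@(cfg q l h r) with halting q
  ... | true  = c
  ... | false with δ q h
  ...   | q' , s , m with moveHead m l s r
  ...     | l' , h' , r' = cfg q' l' h' r'

  run : ℕ → Config → Config
  run zero c = c
  run (suc t) c = run t (step c)

  -- output: maximal block of bit symbols starting at the head
  readBits : List Γ → List Bool
  readBits [] = []
  readBits (zero ∷ _) = []
  readBits (suc zero ∷ xs) = false ∷ readBits xs
  readBits (suc (suc zero) ∷ xs) = true ∷ readBits xs
  readBits (suc (suc (suc _)) ∷ _) = []

  HaltsWith : List Bool → ℕ → List Bool → Set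
  HaltsWith w t out =
    let c = run t (initConfig w) in
    halting (Config.state c) ≡ true ×
    readBits (Config.head c ∷ Config.right c) ≡ out

_≤P_ : Language → Language → Set
A ≤P B =
  Σ TM λ M → Σ ℕ λ c → Σ ℕ λ d →
    (w : List Bool) → Σ (List Bool) λ out → Σ ℕ λ t →
      t ≤ c * (length w) ^ d + c × HaltsWith M w t out × (A w ⇔ B out)

{-# OPTIONS --safe #-}
-- Appending b_{m+1} = b_0 - b_0, b_{m+2} = b_{m+1} - b_m and b_{m+3} = b_{m+2} * b_m to an SLP
-- (b_0, ..., b_m) for N gives an SLP for -N², and -N² is a sum of two squares iff N = 0.  So the
-- reduction copies an encoded nonempty SLP and appends the encoding of these three instructions;
-- every other input goes to the string 1, which encodes no SLP (the empty SLP represents 1 ≠ 0).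
-- The appended indices are the unary numerals m+1, m, m+2, m, where m is the number of input
-- instructions.  A single-tape machine writes them in quadratic time: while copying it tags the
-- first bit of every instruction with level 4, and each of four passes repeatedly walks left to the
-- last instruction still tagged with the current level, lowers its tag and appends a 1 on the right.

module Submission where

open import Defs
import Algebra.Solver.Monoid
open import Data.Bool using (Bool; true; false)
open import Data.Bool.Properties using (T-≡)
open import Data.Fin using (Fin; zero; suc; #_)
open import Data.Integer as ℤ using (ℤ; 0ℤ; 1ℤ)
import Data.Integer.Properties as ℤ
open import Data.List using (List; []; _∷_; _++_; _∷ʳ_; [_]; length; map; concatMap; replicate; reverse)
open import Data.List.Properties
  using (++-monoid; ++-assoc; ++-identityʳ; map-++; length-++; length-map; length-replicate; concatMap-++; ∷ʳ-++;
         reverse-++; length-++-≤ˡ; length-++-≤ʳ)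
open import Data.List.Relation.Unary.All using (All; []; _∷_; universal)
import Data.List.Relation.Unary.All.Properties as All
open import Data.List.Reverse using (Reverse; []; _∶_∶ʳ_; reverseView)
open import Data.Maybe using (Maybe; just; nothing)
import Data.Maybe as Maybe
open import Data.Maybe.Properties using (just-injective)
open import Data.Nat using (ℕ; zero; suc; _+_; _*_; _^_; _∸_; _≤_; _≡ᵇ_; z≤n; s≤s)
open import Data.Nat.Properties
  using (≡ᵇ⇒≡; ≡⇒≡ᵇ; ≤-refl; ≤-reflexive; ≤-trans; +-suc; +-comm; +-identityʳ; *-identityʳ; +-mono-≤; +-monoˡ-≤;
         +-monoʳ-≤; *-mono-≤; *-monoˡ-≤; *-monoʳ-≤; m≤m+n; m≤n+m; m≤m*n; m≤n*m; n≤1+n; m≤n⇒m≤1+n; <⇒≢; n<1+n;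
         m<n⇒m<1+n; m+[n∸m]≡n; module ≤-Reasoning)
open import Data.Nat.Solver using (module +-*-Solver)
open import Data.Product using (Σ; ∃-syntax; _×_; _,_; proj₁)
open import Data.Sum using (_⊎_; inj₁; inj₂)
open import Data.Unit using (tt)
open import Data.Vec using (Vec; lookup; _∷_; [])
open import Function.Bundles using (_⇔_; mk⇔; Equivalence; _↪_; mk↪; module RightInverse)
open import Function.Consequences.Propositional using (strictlyInverseʳ⇒inverseʳ)
import Function.Properties.Equivalence as ⇔
open import Relation.Binary.PropositionalEquality
  using (_≡_; _≢_; refl; sym; trans; cong; cong₂; subst; subst₂; module ≡-Reasoning)
open import Relation.Nullary using (¬_; contradiction)

-- Straight-line programs and the gadget

extend-same : ∀ env n v → extend env n v n ≡ v
extend-same env n v rewrite Equivalence.to T-≡ (≡⇒≡ᵇ n n refl) = refl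

extend-other : ∀ env {n} v {m} → m ≢ n → extend env n v m ≡ env m
extend-other env {n} v {m} m≢n with m ≡ᵇ n in eq
... | true  = contradiction (≡ᵇ⇒≡ m n (Equivalence.from T-≡ eq)) m≢n
... | false = refl

entriesAfter : (ℕ → ℤ) → ℕ → SLP → (ℕ → ℤ)
entriesAfter env i []                = env
entriesAfter env i ((o , j , k) ∷ P) = entriesAfter (extend env (suc i) (applyOp o (env j) (env k))) (suc i) P

evalFrom-++ : ∀ env i P Q → evalFrom env i (P ++ Q) ≡ evalFrom (entriesAfter env i P) (length P + i) Q
evalFrom-++ env i []                Q = refl
evalFrom-++ env i ((o , j , k) ∷ P) Q =
  trans (evalFrom-++ (extend env (suc i) (applyOp o (env j) (env k))) (suc i) P Q)
        (cong (λ n → evalFrom (entriesAfter (extend env (suc i) (applyOp o (env j) (env k))) (suc i) P) n Q)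
              (+-suc (length P) i))

value-++ : ∀ P Q → value (P ++ Q) ≡ evalFrom (entriesAfter (λ _ → 1ℤ) 0 P) (length P) Q
value-++ P Q = trans (evalFrom-++ (λ _ → 1ℤ) 0 P Q) (cong (λ n → evalFrom (entriesAfter (λ _ → 1ℤ) 0 P) n Q) (+-identityʳ (length P)))

value≡lastEntry : ∀ P → value P ≡ entriesAfter (λ _ → 1ℤ) 0 P (length P)
value≡lastEntry P = trans (cong value (sym (++-identityʳ P))) (value-++ P [])

negSquareGadget : ℕ → SLP
negSquareGadget m = (sub , 0 , 0) ∷ (sub , suc m , m) ∷ (mul , suc (suc m) , m) ∷ []

appendNegSquare : SLP → SLP
appendNegSquare P = P ++ negSquareGadget (length P)

evalFrom-negSquareGadget : ∀ env m → evalFrom env m (negSquareGadget m) ≡ ((env 0 ℤ.- env 0) ℤ.- env m) ℤ.* env m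
evalFrom-negSquareGadget env m = begin
  env₃ (3 + m)                             ≡⟨ extend-same env₂ (3 + m) _ ⟩
  env₂ (2 + m) ℤ.* env₂ m                  ≡⟨ cong₂ ℤ._*_ (extend-same env₁ (2 + m) _) (extend-other env₁ _ m≢2+m) ⟩
  (env₁ (1 + m) ℤ.- env₁ m) ℤ.* env₁ m
    ≡⟨ cong₂ (λ x y → (x ℤ.- y) ℤ.* y) (extend-same env (1 + m) _) (extend-other env _ m≢1+m) ⟩
  ((env 0 ℤ.- env 0) ℤ.- env m) ℤ.* env m  ∎
  where
  open ≡-Reasoning
  env₁ = extend env (1 + m) (env 0 ℤ.- env 0)
  env₂ = extend env₁ (2 + m) (env₁ (1 + m) ℤ.- env₁ m)
  env₃ = extend env₂ (3 + m) (env₂ (2 + m) ℤ.* env₂ m)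
  m≢1+m : m ≢ 1 + m
  m≢1+m = <⇒≢ (n<1+n m)
  m≢2+m : m ≢ 2 + m
  m≢2+m = <⇒≢ (m<n⇒m<1+n (n<1+n m))

value-appendNegSquare : ∀ P → value (appendNegSquare P) ≡ ℤ.- (value P ℤ.* value P)
value-appendNegSquare P = begin
  value (appendNegSquare P)                  ≡⟨ value-++ P (negSquareGadget (length P)) ⟩
  evalFrom env (length P) (negSquareGadget (length P))
                                             ≡⟨ evalFrom-negSquareGadget env (length P) ⟩
  ((env 0 ℤ.- env 0) ℤ.- N) ℤ.* N            ≡⟨ cong (λ x → (x ℤ.- N) ℤ.* N) (ℤ.+-inverseʳ (env 0)) ⟩
  (0ℤ ℤ.- N) ℤ.* N                           ≡⟨ cong (ℤ._* N) (ℤ.+-identityˡ (ℤ.- N)) ⟩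
  ℤ.- N ℤ.* N                                ≡⟨ sym (ℤ.neg-distribˡ-* N N) ⟩
  ℤ.- (N ℤ.* N)                              ≡⟨ cong (λ x → ℤ.- (x ℤ.* x)) (sym (value≡lastEntry P)) ⟩
  ℤ.- (value P ℤ.* value P)                  ∎
  where
  open ≡-Reasoning
  env = entriesAfter (λ _ → 1ℤ) 0 P
  N   = env (length P)

square≡+∣∣² : ∀ a → a ℤ.* a ≡ ℤ.+ (ℤ.∣ a ∣ * ℤ.∣ a ∣)
square≡+∣∣² (ℤ.+ n)    = ℤ.+◃n≡+n (n * n)
square≡+∣∣² ℤ.-[1+ n ] = ℤ.+◃n≡+n (suc n * suc n)

negSquare-sos⇔zero : ∀ N → IsSumOfTwoSquares (ℤ.- (N ℤ.* N)) ⇔ N ≡ 0ℤ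
negSquare-sos⇔zero N = mk⇔ (sos⇒zero N) (λ { refl → 0ℤ , 0ℤ , refl })
  where
  sos⇒zero : ∀ N → IsSumOfTwoSquares (ℤ.- (N ℤ.* N)) → N ≡ 0ℤ
  sos⇒zero (ℤ.+ zero) _           = refl
  sos⇒zero ℤ.+[1+ n ] (a , b , e) = contradiction (trans e (cong₂ ℤ._+_ (square≡+∣∣² a) (square≡+∣∣² b))) λ ()
  sos⇒zero ℤ.-[1+ n ] (a , b , e) = contradiction (trans e (cong₂ ℤ._+_ (square≡+∣∣² a) (square≡+∣∣² b))) λ ()

WF-++⁻ : ∀ i P Q → WF i (P ++ Q) → WF i P
WF-++⁻ i []                Q _               = tt
WF-++⁻ i ((o , j , k) ∷ P) Q (j≤i , k≤i , wf) = j≤i , k≤i , WF-++⁻ (suc i) P Q wf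

WF-++⁺ : ∀ i P Q → WF i P → WF (length P + i) Q → WF i (P ++ Q)
WF-++⁺ i []                Q _                 wfQ = wfQ
WF-++⁺ i ((o , j , k) ∷ P) Q (j≤i , k≤i , wfP) wfQ =
  j≤i , k≤i , WF-++⁺ (suc i) P Q wfP (subst (λ n → WF n Q) (sym (+-suc (length P) i)) wfQ)

WF-negSquareGadget : ∀ m → WF m (negSquareGadget m)
WF-negSquareGadget m = z≤n , z≤n , ≤-refl , n≤1+n m , ≤-refl , m≤n⇒m≤1+n (n≤1+n m) , tt

appendNegSquare-correct : ∀ P → (WF 0 P × value P ≡ 0ℤ) ⇔ (WF 0 (appendNegSquare P) × IsSumOfTwoSquares (value (appendNegSquare P)))
appendNegSquare-correct P = mk⇔ to from
  where
  gadget = negSquareGadget (length P)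
  to : WF 0 P × value P ≡ 0ℤ → WF 0 (appendNegSquare P) × IsSumOfTwoSquares (value (appendNegSquare P))
  to (wf , N≡0) =
    WF-++⁺ 0 P gadget wf (subst (λ i → WF i gadget) (sym (+-identityʳ (length P))) (WF-negSquareGadget (length P))) ,
    subst IsSumOfTwoSquares (sym (value-appendNegSquare P)) (Equivalence.from (negSquare-sos⇔zero (value P)) N≡0)
  from : WF 0 (appendNegSquare P) × IsSumOfTwoSquares (value (appendNegSquare P)) → WF 0 P × value P ≡ 0ℤ
  from (wf , sos) =
    WF-++⁻ 0 P gadget wf ,
    Equivalence.to (negSquare-sos⇔zero (value P)) (subst IsSumOfTwoSquares (value-appendNegSquare P) sos)

-- Parsing encoded programs

mutual
  parse : List Bool → Maybe SLP
  parse []      = just []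
  parse (b ∷ u) = parseOp b u

  parseOp : Bool → List Bool → Maybe SLP
  parseOp false (false ∷ u) = parseFirstIndex add 0 u
  parseOp false (true  ∷ u) = parseFirstIndex sub 0 u
  parseOp true  (false ∷ u) = parseFirstIndex mul 0 u
  parseOp true  (true  ∷ u) = nothing
  parseOp false []          = nothing
  parseOp true  []          = nothing

  parseFirstIndex : Op → ℕ → List Bool → Maybe SLP
  parseFirstIndex o j []          = nothing
  parseFirstIndex o j (true  ∷ u) = parseFirstIndex o (suc j) u
  parseFirstIndex o j (false ∷ u) = parseSecondIndex o j 0 u

  parseSecondIndex : Op → ℕ → ℕ → List Bool → Maybe SLP
  parseSecondIndex o j k []          = nothing
  parseSecondIndex o j k (true  ∷ u) = parseSecondIndex o j (suc k) u
  parseSecondIndex o j k (false ∷ u) = Maybe.map ((o , j , k) ∷_) (parse u)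

encNat-++ : ∀ j u → encNat j ++ u ≡ replicate j true ++ false ∷ u
encNat-++ j u = ++-assoc (replicate j true) [ false ] u

replicate-suc-++ : ∀ {A : Set} n (x : A) u → replicate (suc n) x ++ u ≡ replicate n x ++ x ∷ u
replicate-suc-++ zero    x u = refl
replicate-suc-++ (suc n) x u = cong (x ∷_) (replicate-suc-++ n x u)

parse-encOp : ∀ o u → parse (encOp o ++ u) ≡ parseFirstIndex o 0 u
parse-encOp add u = refl
parse-encOp sub u = refl
parse-encOp mul u = refl

parseFirstIndex-encNat : ∀ o i j u → parseFirstIndex o i (encNat j ++ u) ≡ parseSecondIndex o (i + j) 0 u
parseFirstIndex-encNat o i zero    u = cong (λ n → parseSecondIndex o n 0 u) (sym (+-identityʳ i))
parseFirstIndex-encNat o i (suc j) u =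
  trans (parseFirstIndex-encNat o (suc i) j u) (cong (λ n → parseSecondIndex o n 0 u) (sym (+-suc i j)))

parseSecondIndex-encNat : ∀ o j i k u → parseSecondIndex o j i (encNat k ++ u) ≡ Maybe.map ((o , j , i + k) ∷_) (parse u)
parseSecondIndex-encNat o j i zero    u = cong (λ n → Maybe.map ((o , j , n) ∷_) (parse u)) (sym (+-identityʳ i))
parseSecondIndex-encNat o j i (suc k) u =
  trans (parseSecondIndex-encNat o j (suc i) k u) (cong (λ n → Maybe.map ((o , j , n) ∷_) (parse u)) (sym (+-suc i k)))

parse-encInstr : ∀ o j k u → parse (encInstr (o , j , k) ++ u) ≡ Maybe.map ((o , j , k) ∷_) (parse u)
parse-encInstr o j k u = begin
  parse ((encOp o ++ encNat j ++ encNat k) ++ u)      ≡⟨ cong parse (++-assoc (encOp o) (encNat j ++ encNat k) u) ⟩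
  parse (encOp o ++ (encNat j ++ encNat k) ++ u)      ≡⟨ parse-encOp o _ ⟩
  parseFirstIndex o 0 ((encNat j ++ encNat k) ++ u)   ≡⟨ cong (parseFirstIndex o 0) (++-assoc (encNat j) (encNat k) u) ⟩
  parseFirstIndex o 0 (encNat j ++ encNat k ++ u)     ≡⟨ parseFirstIndex-encNat o 0 j _ ⟩
  parseSecondIndex o j 0 (encNat k ++ u)              ≡⟨ parseSecondIndex-encNat o j 0 k u ⟩
  Maybe.map ((o , j , k) ∷_) (parse u)                ∎
  where open ≡-Reasoning

parse-encSLP : ∀ P → parse (encSLP P) ≡ just P
parse-encSLP []                = refl
parse-encSLP ((o , j , k) ∷ P) =
  trans (parse-encInstr o j k (encSLP P)) (cong (Maybe.map ((o , j , k) ∷_)) (parse-encSLP P))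

encSLP-injective : ∀ {P Q} → encSLP P ≡ encSLP Q → P ≡ Q
encSLP-injective {P} {Q} e = just-injective (trans (sym (parse-encSLP P)) (trans (cong parse e) (parse-encSLP Q)))

mutual
  parse-sound : ∀ u {P} → parse u ≡ just P → encSLP P ≡ u
  parse-sound []      refl = refl
  parse-sound (b ∷ u) e    = parseOp-sound b u e

  parseOp-sound : ∀ b u {P} → parseOp b u ≡ just P → encSLP P ≡ b ∷ u
  parseOp-sound false (false ∷ u) e = parseFirstIndex-sound add 0 u e
  parseOp-sound false (true  ∷ u) e = parseFirstIndex-sound sub 0 u e
  parseOp-sound true  (false ∷ u) e = parseFirstIndex-sound mul 0 u e

  parseFirstIndex-sound : ∀ o j u {P} → parseFirstIndex o j u ≡ just P → encSLP P ≡ encOp o ++ replicate j true ++ u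
  parseFirstIndex-sound o j (true ∷ u) e =
    trans (parseFirstIndex-sound o (suc j) u e) (cong (encOp o ++_) (replicate-suc-++ j true u))
  parseFirstIndex-sound o j (false ∷ u) e =
    trans (parseSecondIndex-sound o j 0 u e) (cong (encOp o ++_) (encNat-++ j u))

  parseSecondIndex-sound : ∀ o j k u {P} → parseSecondIndex o j k u ≡ just P →
                           encSLP P ≡ encOp o ++ encNat j ++ replicate k true ++ u
  parseSecondIndex-sound o j k (true ∷ u) e =
    trans (parseSecondIndex-sound o j (suc k) u e) (cong (λ v → encOp o ++ encNat j ++ v) (replicate-suc-++ k true u))
  parseSecondIndex-sound o j k (false ∷ u) e with parse u in parsed
  parseSecondIndex-sound o j k (false ∷ u) refl | just Q = begin
    (encOp o ++ encNat j ++ encNat k) ++ encSLP Q   ≡⟨ cong ((encOp o ++ encNat j ++ encNat k) ++_) (parse-sound u parsed) ⟩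
    (encOp o ++ encNat j ++ encNat k) ++ u          ≡⟨ ++-assoc (encOp o) (encNat j ++ encNat k) u ⟩
    encOp o ++ (encNat j ++ encNat k) ++ u          ≡⟨ cong (encOp o ++_) (++-assoc (encNat j) (encNat k) u) ⟩
    encOp o ++ encNat j ++ encNat k ++ u            ≡⟨ cong (λ v → encOp o ++ encNat j ++ v) (encNat-++ k u) ⟩
    encOp o ++ encNat j ++ replicate k true ++ false ∷ u ∎
    where open ≡-Reasoning

encSLP-member⇔ : ∀ (Holds : ℤ → Set) P →
                 (Σ SLP λ P′ → WF 0 P′ × encSLP P′ ≡ encSLP P × Holds (value P′)) ⇔ (WF 0 P × Holds (value P))
encSLP-member⇔ Holds P = mk⇔ to (λ (wf , r) → P , wf , refl , r)
  where
  to : (Σ SLP λ P′ → WF 0 P′ × encSLP P′ ≡ encSLP P × Holds (value P′)) → WF 0 P × Holds (value P)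
  to (P′ , wf , e , r) = subst (λ P″ → WF 0 P″ × Holds (value P″)) (encSLP-injective e) (wf , r)

encSLP≢[true] : ∀ P → encSLP P ≢ true ∷ []
encSLP≢[true] ((add , _ , _) ∷ _) ()
encSLP≢[true] ((sub , _ , _) ∷ _) ()
encSLP≢[true] ((mul , _ , _) ∷ _) ()

-- Turing machines given by transition tables

module Runs (M : TM) where

  Halted : Config M → List Bool → Set
  Halted c out =
    TM.halting M (Config.state c) ≡ true ×
    readBits M (Config.head c ∷ Config.right c) ≡ out

  run-+ : ∀ a b c → run M (a + b) c ≡ run M b (run M a c)
  run-+ zero    b c = refl
  run-+ (suc a) b c = run-+ a b (step M c)

  run-suc : ∀ n c → run M (suc n) c ≡ step M (run M n c)
  run-suc zero    c = refl
  run-suc (suc n) c = run-suc n (step M c)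

  run-halted : ∀ k c → TM.halting M (Config.state c) ≡ true → run M k c ≡ c
  run-halted zero    c               h = refl
  run-halted (suc k) c@(cfg q l x r) h rewrite h = run-halted k c h

  placed : Fin (TM.nstates M) → List (Γ M) × Γ M × List (Γ M) → Config M
  placed q (l , x , r) = cfg q l x r

  step-active : ∀ {q l x r q′ s d} → TM.halting M q ≡ false → TM.δ M q x ≡ (q′ , s , d) →
                step M (cfg q l x r) ≡ placed q′ (moveHead M d l s r)
  step-active h e rewrite h | e = refl

  infix  3 _⇒⟨_⟩_
  infixr 4 _▸_

  _⇒⟨_⟩_ : Config M → ℕ → Config M → Set
  c ⇒⟨ k ⟩ c′ = ∃[ n ] n ≤ k × run M n c ≡ c′

  exactly : ∀ {c c′} n → run M n c ≡ c′ → c ⇒⟨ n ⟩ c′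
  exactly n e = n , ≤-refl , e

  _▸_ : ∀ {c c′ c″ a b} → c ⇒⟨ a ⟩ c′ → c′ ⇒⟨ b ⟩ c″ → c ⇒⟨ a + b ⟩ c″
  _▸_ {c} (n , n≤a , e) (n′ , n′≤b , e′) =
    n + n′ , +-mono-≤ n≤a n′≤b , trans (run-+ n n′ c) (trans (cong (run M n′) e) e′)

  retarget : ∀ {c c′ c″ k} → c ⇒⟨ k ⟩ c′ → c′ ≡ c″ → c ⇒⟨ k ⟩ c″
  retarget (n , n≤k , e) refl = n , n≤k , e

  relax : ∀ {c c′ a b} → a ≤ b → c ⇒⟨ a ⟩ c′ → c ⇒⟨ b ⟩ c′
  relax a≤b (n , n≤a , e) = n , ≤-trans n≤a a≤b , e

  HaltsWithin : Config M → ℕ → List Bool → Set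
  HaltsWithin c k out = ∃[ c′ ] c ⇒⟨ k ⟩ c′ × Halted c′ out

  infixr 4 _▸ₕ_

  _▸ₕ_ : ∀ {c c′ a b out} → c ⇒⟨ a ⟩ c′ → HaltsWithin c′ b out → HaltsWithin c (a + b) out
  r ▸ₕ (c″ , r′ , h) = c″ , (r ▸ r′) , h

  relaxₕ : ∀ {c a b out} → a ≤ b → HaltsWithin c a out → HaltsWithin c b out
  relaxₕ a≤b (c′ , r , h) = c′ , relax a≤b r , h

  halted-after : ∀ {c k out} t → HaltsWithin c k out → k ≤ t → Halted (run M t c) out
  halted-after {c} t (_ , (n , n≤k , refl) , h) k≤t =
    subst (λ c′ → Halted c′ _) (sym ran) h
    where
    ran : run M t c ≡ run M n c
    ran = begin
      run M t c                   ≡⟨ cong (λ i → run M i c) (sym (m+[n∸m]≡n (≤-trans n≤k k≤t))) ⟩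
      run M (n + (t ∸ n)) c       ≡⟨ run-+ n (t ∸ n) c ⟩
      run M (t ∸ n) (run M n c)   ≡⟨ run-halted (t ∸ n) (run M n c) (proj₁ h) ⟩
      run M n c                   ∎
      where open ≡-Reasoning

module Tabulated
  {State Symbol : Set} {nstates extra : ℕ}
  (states : State ↪ Fin nstates) (symbols : Symbol ↪ Fin (3 + extra))
  (void : Symbol) (void-blank : RightInverse.to symbols void ≡ zero)
  (start : State) (halting : State → Bool) (δ : State → Symbol → State × Symbol × Move)
  where

  open RightInverse states
    renaming (to to encodeState; from to decodeState; strictlyInverseʳ to decode-encodeState)
  open RightInverse symbols
    renaming (to to encodeSymbol; from to decodeSymbol; strictlyInverseʳ to decode-encodeSymbol)

  encodeAction : State × Symbol × Move → Fin nstates × Fin (3 + extra) × Move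
  encodeAction (q , s , d) = encodeState q , encodeSymbol s , d

  machine : TM
  machine = record
    { nstates = nstates
    ; extra   = extra
    ; start   = encodeState start
    ; halting = λ q → halting (decodeState q)
    ; δ       = λ q x → encodeAction (δ (decodeState q) (decodeSymbol x))
    }

  open Runs machine public

  current : List Symbol → Symbol
  current []      = void
  current (x ∷ _) = x

  following : List Symbol → List Symbol
  following []      = []
  following (_ ∷ B) = B

  -- A is the tape left of the head in reading order; the head scans the first cell of B (a blank if B = []).
  at : State → List Symbol → List Symbol → Config machine
  at q A B = cfg (encodeState q) (map encodeSymbol (reverse A))
                 (encodeSymbol (current B)) (map encodeSymbol (following B))

  private
    active : ∀ {q q′ s d x} → halting q ≡ false → δ q x ≡ (q′ , s , d) →
             ∀ {l r} → step machine (cfg (encodeState q) l (encodeSymbol x) r)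
                       ≡ placed (encodeState q′) (moveHead machine d l (encodeSymbol s) r)
    active {q} {x = x} h e = step-active
      (trans (cong halting (decode-encodeState q)) h)
      (cong encodeAction (trans (cong₂ δ (decode-encodeState q) (decode-encodeSymbol x)) e))

    reverse-∷ʳ : ∀ A (s : Symbol) → map encodeSymbol (reverse (A ∷ʳ s)) ≡ encodeSymbol s ∷ map encodeSymbol (reverse A)
    reverse-∷ʳ A s = cong (map encodeSymbol) (reverse-++ A [ s ])

  step-right : ∀ q {q′ s} A B → halting q ≡ false → δ q (current B) ≡ (q′ , s , R) →
               step machine (at q A B) ≡ at q′ (A ∷ʳ s) (following B)
  step-right q {q′} {s} A [] h e =
    trans (active h e) (cong₂ (λ l x → cfg (encodeState q′) l x []) (sym (reverse-∷ʳ A s)) (sym void-blank))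
  step-right q {q′} {s} A (_ ∷ []) h e =
    trans (active h e) (cong₂ (λ l x → cfg (encodeState q′) l x []) (sym (reverse-∷ʳ A s)) (sym void-blank))
  step-right q {q′} {s} A (_ ∷ x ∷ B) h e =
    trans (active h e) (cong (λ l → cfg (encodeState q′) l (encodeSymbol x) (map encodeSymbol B)) (sym (reverse-∷ʳ A s)))

  step-left : ∀ q {q′ s} A y B → halting q ≡ false → δ q (current B) ≡ (q′ , s , L) →
              step machine (at q (A ∷ʳ y) B) ≡ at q′ A (y ∷ s ∷ following B)
  step-left q A y B h e rewrite reverse-∷ʳ A y = active h e

  step-stay : ∀ q {q′ s} A B → halting q ≡ false → δ q (current B) ≡ (q′ , s , S) →
              step machine (at q A B) ≡ at q′ A (s ∷ following B)
  step-stay q A B h e = active h e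

  Skips : Move → State → Symbol → Set
  Skips d q x = δ q x ≡ (q , x , d)

  scan-right : ∀ q {xs} → halting q ≡ false → All (Skips R q) xs → ∀ A B →
               run machine (length xs) (at q A (xs ++ B)) ≡ at q (A ++ xs) B
  scan-right q h [] A B = cong (λ A′ → at q A′ B) (sym (++-identityʳ A))
  scan-right q {x ∷ xs} h (e ∷ es) A B = begin
    run machine (length xs) (step machine (at q A (x ∷ xs ++ B)))  ≡⟨ cong (run machine (length xs)) (step-right q A (x ∷ xs ++ B) h e) ⟩
    run machine (length xs) (at q (A ∷ʳ x) (xs ++ B))              ≡⟨ scan-right q h es (A ∷ʳ x) B ⟩
    at q ((A ∷ʳ x) ++ xs) B                                        ≡⟨ cong (λ A′ → at q A′ B) (++-assoc A [ x ] xs) ⟩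
    at q (A ++ x ∷ xs) B                                           ∎
    where open ≡-Reasoning

  scan-left : ∀ q {xs B} → halting q ≡ false → Skips L q (current B) → All (Skips L q) xs → ∀ A t →
              run machine (suc (length xs)) (at q (A ++ t ∷ xs) B) ≡ at q A (t ∷ xs ++ current B ∷ following B)
  scan-left q {[]} {B} h e [] A t = step-left q A t B h e
  scan-left q {x ∷ xs} {B} h e (ex ∷ es) A t = begin
    run machine (suc (suc (length xs))) (at q (A ++ t ∷ x ∷ xs) B)
      ≡⟨ cong (λ A′ → run machine (suc (suc (length xs))) (at q A′ B)) (sym (++-assoc A [ t ] (x ∷ xs))) ⟩
    run machine (suc (suc (length xs))) (at q ((A ∷ʳ t) ++ x ∷ xs) B)
      ≡⟨ run-suc (suc (length xs)) _ ⟩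
    step machine (run machine (suc (length xs)) (at q ((A ∷ʳ t) ++ x ∷ xs) B))
      ≡⟨ cong (step machine) (scan-left q {B = B} h e es (A ∷ʳ t) x) ⟩
    step machine (at q (A ∷ʳ t) (x ∷ xs ++ current B ∷ following B))
      ≡⟨ step-left q A t (x ∷ xs ++ current B ∷ following B) h ex ⟩
    at q A (t ∷ x ∷ xs ++ current B ∷ following B) ∎
    where open ≡-Reasoning

  Writes : State → List Symbol → State → Set
  Writes q []      q′ = q ≡ q′
  Writes q (s ∷ w) q′ = ∃[ q₁ ] halting q ≡ false × δ q void ≡ (q₁ , s , R) × Writes q₁ w q′

  write-run : ∀ {q q′} w → Writes q w q′ → ∀ A → run machine (length w) (at q A []) ≡ at q′ (A ++ w) []
  write-run []      refl A = cong (λ A′ → at _ A′ []) (sym (++-identityʳ A))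
  write-run {q} {q′} (s ∷ w) (q₁ , h , e , ws) A = begin
    run machine (length w) (step machine (at q A []))  ≡⟨ cong (run machine (length w)) (step-right q A [] h e) ⟩
    run machine (length w) (at q₁ (A ∷ʳ s) [])         ≡⟨ write-run w ws (A ∷ʳ s) ⟩
    at q′ ((A ∷ʳ s) ++ w) []                           ≡⟨ cong (λ A′ → at q′ A′ []) (++-assoc A [ s ] w) ⟩
    at q′ (A ++ s ∷ w) []                              ∎
    where open ≡-Reasoning

  round-trip : ∀ q q′ {q″ t t′ xs} w → halting q ≡ false → Skips L q void → All (Skips L q) xs →
               δ q t ≡ (q′ , t′ , R) → halting q′ ≡ false → All (Skips R q′) xs → Writes q′ w q″ → ∀ A →
               at q (A ++ t ∷ xs) [] ⇒⟨ suc (length xs) + (1 + (length xs + length w)) ⟩ at q″ (A ++ t′ ∷ xs ++ w) []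
  round-trip q q′ {q″} {t} {t′} {xs} w h void-L xs-L turn h′ xs-R writes A =
    exactly (suc (length xs)) (scan-left q {B = []} h void-L xs-L A t) ▸
    exactly 1 (step-right q A (t ∷ xs ++ [ void ]) h turn) ▸
    exactly (length xs) (scan-right q′ h′ xs-R (A ∷ʳ t′) [ void ]) ▸
    retarget (exactly (length w) (write-run w writes ((A ∷ʳ t′) ++ xs)))
             (cong (λ A′ → at q″ A′ []) (trans (++-assoc (A ∷ʳ t′) xs w) (++-assoc A [ t′ ] (xs ++ w))))

-- The reduction machine

data Level : Set where
  lv0 lv1 lv2 lv3 lv4 : Level

lower : Level → Level
lower lv0 = lv0
lower lv1 = lv0
lower lv2 = lv1
lower lv3 = lv2
lower lv4 = lv3

data Positive : Level → Set where
  lv1⁺ : Positive lv1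
  lv2⁺ : Positive lv2
  lv3⁺ : Positive lv3
  lv4⁺ : Positive lv4

data Symbol : Set where
  void stop : Symbol
  bit       : Bool → Symbol
  mark      : Level → Bool → Symbol
  markFirst : Level → Bool → Symbol

-- mark lv0 is never written: tagging at level 0 leaves a plain bit.
tag : Level → Bool → Symbol
tag lv0 = bit
tag l   = mark l

data State : Set where
  readFirstInstr readNextInstr : State
  readOp : Bool → State
  readFirstIndex readSecondIndex : State
  reject halt : State
  writePrefix₁ writePrefix₂ writePrefix₃ writePrefix₄ writePrefix₅ writePrefix₆ : State
  seek append close separate : Level → State
  writeMul₁ writeMul₂ writeMul₃ writeMul₄ : State

rejectAction : State × Symbol × Move
rejectAction = reject , bit true , R

seekMark : Level → Level → Bool → State × Symbol × Move
seekMark lv1 lv1 b = append lv1 , tag lv0 b , R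
seekMark lv2 lv2 b = append lv2 , tag lv1 b , R
seekMark lv3 lv3 b = append lv3 , tag lv2 b , R
seekMark lv4 lv4 b = append lv4 , tag lv3 b , R
seekMark l   l′  b = seek l , mark l′ b , L

seekFirst : Level → Level → Bool → State × Symbol × Move
seekFirst lv0 lv0 b = halt , bit b , S
seekFirst lv1 lv1 b = close lv1 , markFirst lv0 b , R
seekFirst lv2 lv2 b = close lv2 , markFirst lv1 b , R
seekFirst lv3 lv3 b = close lv3 , markFirst lv2 b , R
seekFirst lv4 lv4 b = close lv4 , markFirst lv3 b , R
seekFirst l   l′  b = seek l , markFirst l′ b , L

δ : State → Symbol → State × Symbol × Move
δ readFirstInstr  (bit b)          = readOp b , markFirst lv4 b , R
δ readFirstInstr  _                = rejectAction
δ readNextInstr   (bit b)          = readOp b , mark lv4 b , R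
δ readNextInstr   void             = writePrefix₁ , bit false , R
δ readNextInstr   _                = rejectAction
δ (readOp true)   (bit true)       = rejectAction
δ (readOp _)      (bit b)          = readFirstIndex , bit b , R
δ (readOp _)      _                = rejectAction
δ readFirstIndex  (bit true)       = readFirstIndex , bit true , R
δ readFirstIndex  (bit false)      = readSecondIndex , bit false , R
δ readFirstIndex  _                = rejectAction
δ readSecondIndex (bit true)       = readSecondIndex , bit true , R
δ readSecondIndex (bit false)      = readNextInstr , bit false , R
δ readSecondIndex _                = rejectAction
δ reject          _                = halt , stop , L
δ halt            x                = halt , x , S
δ writePrefix₁    _                = writePrefix₂ , bit true , R
δ writePrefix₂    _                = writePrefix₃ , bit false , R
δ writePrefix₃    _                = writePrefix₄ , bit false , R
δ writePrefix₄    _                = writePrefix₅ , bit false , R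
δ writePrefix₅    _                = writePrefix₆ , bit true , R
δ writePrefix₆    _                = seek lv4 , bit true , R
δ (seek l)        (mark l′ b)      = seekMark l l′ b
δ (seek l)        (markFirst l′ b) = seekFirst l l′ b
δ (seek l)        x                = seek l , x , L
δ (append l)      void             = seek l , bit true , R
δ (append l)      x                = append l , x , R
δ (close l)       void             = separate l , bit true , R
δ (close l)       x                = close l , x , R
δ (separate lv3)  _                = writeMul₁ , bit false , R
δ (separate l)    _                = seek (lower l) , bit false , R
δ writeMul₁       _                = writeMul₂ , bit true , R
δ writeMul₂       _                = writeMul₃ , bit false , R
δ writeMul₃       _                = writeMul₄ , bit true , R
δ writeMul₄       _                = seek lv2 , bit true , R

isHalt : State → Bool
isHalt halt = true
isHalt _    = false

encodeSymbol : Symbol → Fin 24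
encodeSymbol void                  = # 0
encodeSymbol (bit false)           = # 1
encodeSymbol (bit true)            = # 2
encodeSymbol stop                  = # 3
encodeSymbol (mark lv0 false)      = # 4
encodeSymbol (mark lv0 true)       = # 5
encodeSymbol (mark lv1 false)      = # 6
encodeSymbol (mark lv1 true)       = # 7
encodeSymbol (mark lv2 false)      = # 8
encodeSymbol (mark lv2 true)       = # 9
encodeSymbol (mark lv3 false)      = # 10
encodeSymbol (mark lv3 true)       = # 11
encodeSymbol (mark lv4 false)      = # 12
encodeSymbol (mark lv4 true)       = # 13
encodeSymbol (markFirst lv0 false) = # 14
encodeSymbol (markFirst lv0 true)  = # 15
encodeSymbol (markFirst lv1 false) = # 16
encodeSymbol (markFirst lv1 true)  = # 17
encodeSymbol (markFirst lv2 false) = # 18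
encodeSymbol (markFirst lv2 true)  = # 19
encodeSymbol (markFirst lv3 false) = # 20
encodeSymbol (markFirst lv3 true)  = # 21
encodeSymbol (markFirst lv4 false) = # 22
encodeSymbol (markFirst lv4 true)  = # 23

symbolTable : Vec Symbol 24
symbolTable =
  void ∷ bit false ∷ bit true ∷ stop ∷
  mark lv0 false ∷ mark lv0 true ∷ mark lv1 false ∷ mark lv1 true ∷ mark lv2 false ∷ mark lv2 true ∷
  mark lv3 false ∷ mark lv3 true ∷ mark lv4 false ∷ mark lv4 true ∷
  markFirst lv0 false ∷ markFirst lv0 true ∷ markFirst lv1 false ∷ markFirst lv1 true ∷
  markFirst lv2 false ∷ markFirst lv2 true ∷ markFirst lv3 false ∷ markFirst lv3 true ∷
  markFirst lv4 false ∷ markFirst lv4 true ∷ []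

decode-encodeSymbol : ∀ x → lookup symbolTable (encodeSymbol x) ≡ x
decode-encodeSymbol void                  = refl
decode-encodeSymbol (bit false)           = refl
decode-encodeSymbol (bit true)            = refl
decode-encodeSymbol stop                  = refl
decode-encodeSymbol (mark lv0 false)      = refl
decode-encodeSymbol (mark lv0 true)       = refl
decode-encodeSymbol (mark lv1 false)      = refl
decode-encodeSymbol (mark lv1 true)       = refl
decode-encodeSymbol (mark lv2 false)      = refl
decode-encodeSymbol (mark lv2 true)       = refl
decode-encodeSymbol (mark lv3 false)      = refl
decode-encodeSymbol (mark lv3 true)       = refl
decode-encodeSymbol (mark lv4 false)      = refl
decode-encodeSymbol (mark lv4 true)       = refl
decode-encodeSymbol (markFirst lv0 false) = refl
decode-encodeSymbol (markFirst lv0 true)  = refl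
decode-encodeSymbol (markFirst lv1 false) = refl
decode-encodeSymbol (markFirst lv1 true)  = refl
decode-encodeSymbol (markFirst lv2 false) = refl
decode-encodeSymbol (markFirst lv2 true)  = refl
decode-encodeSymbol (markFirst lv3 false) = refl
decode-encodeSymbol (markFirst lv3 true)  = refl
decode-encodeSymbol (markFirst lv4 false) = refl
decode-encodeSymbol (markFirst lv4 true)  = refl

encodeState : State → Fin 38
encodeState readFirstInstr  = # 0
encodeState readNextInstr   = # 1
encodeState (readOp false)  = # 2
encodeState (readOp true)   = # 3
encodeState readFirstIndex  = # 4
encodeState readSecondIndex = # 5
encodeState reject          = # 6
encodeState halt            = # 7
encodeState writePrefix₁    = # 8
encodeState writePrefix₂    = # 9
encodeState writePrefix₃    = # 10
encodeState writePrefix₄    = # 11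
encodeState writePrefix₅    = # 12
encodeState writePrefix₆    = # 13
encodeState (seek lv0)      = # 14
encodeState (seek lv1)      = # 15
encodeState (seek lv2)      = # 16
encodeState (seek lv3)      = # 17
encodeState (seek lv4)      = # 18
encodeState (append lv0)    = # 19
encodeState (append lv1)    = # 20
encodeState (append lv2)    = # 21
encodeState (append lv3)    = # 22
encodeState (append lv4)    = # 23
encodeState (close lv0)     = # 24
encodeState (close lv1)     = # 25
encodeState (close lv2)     = # 26
encodeState (close lv3)     = # 27
encodeState (close lv4)     = # 28
encodeState (separate lv0)  = # 29
encodeState (separate lv1)  = # 30
encodeState (separate lv2)  = # 31
encodeState (separate lv3)  = # 32
encodeState (separate lv4)  = # 33
encodeState writeMul₁       = # 34
encodeState writeMul₂       = # 35
encodeState writeMul₃       = # 36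
encodeState writeMul₄       = # 37

stateTable : Vec State 38
stateTable =
  readFirstInstr ∷ readNextInstr ∷ readOp false ∷ readOp true ∷ readFirstIndex ∷ readSecondIndex ∷
  reject ∷ halt ∷
  writePrefix₁ ∷ writePrefix₂ ∷ writePrefix₃ ∷ writePrefix₄ ∷ writePrefix₅ ∷ writePrefix₆ ∷
  seek lv0 ∷ seek lv1 ∷ seek lv2 ∷ seek lv3 ∷ seek lv4 ∷
  append lv0 ∷ append lv1 ∷ append lv2 ∷ append lv3 ∷ append lv4 ∷
  close lv0 ∷ close lv1 ∷ close lv2 ∷ close lv3 ∷ close lv4 ∷
  separate lv0 ∷ separate lv1 ∷ separate lv2 ∷ separate lv3 ∷ separate lv4 ∷
  writeMul₁ ∷ writeMul₂ ∷ writeMul₃ ∷ writeMul₄ ∷ []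

decode-encodeState : ∀ q → lookup stateTable (encodeState q) ≡ q
decode-encodeState readFirstInstr  = refl
decode-encodeState readNextInstr   = refl
decode-encodeState (readOp false)  = refl
decode-encodeState (readOp true)   = refl
decode-encodeState readFirstIndex  = refl
decode-encodeState readSecondIndex = refl
decode-encodeState reject          = refl
decode-encodeState halt            = refl
decode-encodeState writePrefix₁    = refl
decode-encodeState writePrefix₂    = refl
decode-encodeState writePrefix₃    = refl
decode-encodeState writePrefix₄    = refl
decode-encodeState writePrefix₅    = refl
decode-encodeState writePrefix₆    = refl
decode-encodeState (seek lv0)      = refl
decode-encodeState (seek lv1)      = refl
decode-encodeState (seek lv2)      = refl
decode-encodeState (seek lv3)      = refl
decode-encodeState (seek lv4)      = refl
decode-encodeState (append lv0)    = refl
decode-encodeState (append lv1)    = refl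
decode-encodeState (append lv2)    = refl
decode-encodeState (append lv3)    = refl
decode-encodeState (append lv4)    = refl
decode-encodeState (close lv0)     = refl
decode-encodeState (close lv1)     = refl
decode-encodeState (close lv2)     = refl
decode-encodeState (close lv3)     = refl
decode-encodeState (close lv4)     = refl
decode-encodeState (separate lv0)  = refl
decode-encodeState (separate lv1)  = refl
decode-encodeState (separate lv2)  = refl
decode-encodeState (separate lv3)  = refl
decode-encodeState (separate lv4)  = refl
decode-encodeState writeMul₁       = refl
decode-encodeState writeMul₂       = refl
decode-encodeState writeMul₃       = refl
decode-encodeState writeMul₄       = refl

stateCode : State ↪ Fin 38
stateCode = mk↪ {from = lookup stateTable} (strictlyInverseʳ⇒inverseʳ encodeState decode-encodeState)

symbolCode : Symbol ↪ Fin (3 + 21)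
symbolCode = mk↪ {from = lookup symbolTable} (strictlyInverseʳ⇒inverseʳ encodeSymbol decode-encodeSymbol)

open Tabulated stateCode symbolCode void refl readFirstInstr isHalt δ

bits : List Bool → List Symbol
bits = map bit

opBit₁ opBit₂ : Op → Bool
opBit₁ add = false
opBit₁ sub = false
opBit₁ mul = true
opBit₂ add = false
opBit₂ sub = true
opBit₂ mul = false

leadBit : Instr → Bool
leadBit (o , _ , _) = opBit₁ o

trailBits : Instr → List Bool
trailBits (o , j , k) = opBit₂ o ∷ encNat j ++ encNat k

encInstr-bits : ∀ I → encInstr I ≡ leadBit I ∷ trailBits I
encInstr-bits (add , j , k) = refl
encInstr-bits (sub , j , k) = refl
encInstr-bits (mul , j , k) = refl

tagged : (Bool → Symbol) → Instr → List Symbol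
tagged f I = f (leadBit I) ∷ bits (trailBits I)

taggedSLP : Level → SLP → List Symbol
taggedSLP l = concatMap (tagged (tag l))

bits-encInstr : ∀ I → bits (encInstr I) ≡ tagged bit I
bits-encInstr I = cong bits (encInstr-bits I)

bits-encSLP : ∀ Q → bits (encSLP Q) ≡ taggedSLP lv0 Q
bits-encSLP []      = refl
bits-encSLP (I ∷ Q) = trans (map-++ bit (encInstr I) (encSLP Q)) (cong₂ _++_ (bits-encInstr I) (bits-encSLP Q))

bits-encSLP-∷ : ∀ I Q → bits (encSLP (I ∷ Q)) ≡ tagged bit I ++ bits (encSLP Q)
bits-encSLP-∷ I Q = trans (map-++ bit (encInstr I) (encSLP Q)) (cong (_++ bits (encSLP Q)) (bits-encInstr I))

readBits-bits : ∀ u → readBits machine (map encodeSymbol (bits u ++ [ void ])) ≡ u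
readBits-bits []          = refl
readBits-bits (false ∷ u) = cong (false ∷_) (readBits-bits u)
readBits-bits (true ∷ u)  = cong (true ∷_) (readBits-bits u)

initConfig≡at : ∀ w → initConfig machine w ≡ at readFirstInstr [] (bits w)
initConfig≡at []      = refl
initConfig≡at (b ∷ w) = cong₂ (cfg (encodeState readFirstInstr) []) (bitSym≡ b) (map-bitSym w)
  where
  bitSym≡ : ∀ b → bitSym machine b ≡ encodeSymbol (bit b)
  bitSym≡ false = refl
  bitSym≡ true  = refl
  map-bitSym : ∀ w → map (bitSym machine) w ≡ map encodeSymbol (bits w)
  map-bitSym []      = refl
  map-bitSym (b ∷ w) = cong₂ _∷_ (bitSym≡ b) (map-bitSym w)

erase : Symbol → Bool
erase (bit b)         = b
erase (mark _ b)      = b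
erase (markFirst _ b) = b
erase void            = false
erase stop            = false

erase-bits : ∀ u → map erase (bits u) ≡ u
erase-bits []      = refl
erase-bits (b ∷ u) = cong (b ∷_) (erase-bits u)

erase-tagged : ∀ f → (∀ b → erase (f b) ≡ b) → ∀ I → map erase (tagged f I) ≡ encInstr I
erase-tagged f erase-f I =
  trans (cong₂ _∷_ (erase-f (leadBit I)) (erase-bits (trailBits I))) (sym (encInstr-bits I))

erase-tag : ∀ l b → erase (tag l b) ≡ b
erase-tag lv0 b = refl
erase-tag lv1 b = refl
erase-tag lv2 b = refl
erase-tag lv3 b = refl
erase-tag lv4 b = refl

erase-taggedSLP : ∀ l Q → map erase (taggedSLP l Q) ≡ encSLP Q
erase-taggedSLP l []      = refl
erase-taggedSLP l (I ∷ Q) =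
  trans (map-++ erase (tagged (tag l) I) (taggedSLP l Q))
        (cong₂ _++_ (erase-tagged (tag l) (erase-tag l) I) (erase-taggedSLP l Q))

-- The tape during pass l: the first instruction I, the instructions Q₁ still tagged l, those in Q₂
-- already lowered to l - 1, and the output g written so far.
countingTape : Level → Instr → SLP → SLP → List Bool → List Symbol
countingTape l I Q₁ Q₂ g = tagged (markFirst l) I ++ taggedSLP l Q₁ ++ taggedSLP (lower l) Q₂ ++ bits g

erase-countingTape : ∀ l I Q₁ Q₂ g → map erase (countingTape l I Q₁ Q₂ g) ≡ encSLP (I ∷ Q₁ ++ Q₂) ++ g
erase-countingTape l I Q₁ Q₂ g = begin
  map erase (countingTape l I Q₁ Q₂ g)
    ≡⟨ map-++ erase (tagged (markFirst l) I) _ ⟩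
  map erase (tagged (markFirst l) I) ++ map erase (taggedSLP l Q₁ ++ taggedSLP (lower l) Q₂ ++ bits g)
    ≡⟨ cong (map erase (tagged (markFirst l) I) ++_) (map-++ erase (taggedSLP l Q₁) _) ⟩
  map erase (tagged (markFirst l) I) ++ map erase (taggedSLP l Q₁) ++ map erase (taggedSLP (lower l) Q₂ ++ bits g)
    ≡⟨ cong (λ v → map erase (tagged (markFirst l) I) ++ map erase (taggedSLP l Q₁) ++ v) (map-++ erase (taggedSLP (lower l) Q₂) _) ⟩
  map erase (tagged (markFirst l) I) ++ map erase (taggedSLP l Q₁) ++ map erase (taggedSLP (lower l) Q₂) ++ map erase (bits g)
    ≡⟨ cong₂ _++_ (erase-tagged (markFirst l) (λ _ → refl) I)
         (cong₂ _++_ (erase-taggedSLP l Q₁) (cong₂ _++_ (erase-taggedSLP (lower l) Q₂) (erase-bits g))) ⟩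
  encInstr I ++ encSLP Q₁ ++ encSLP Q₂ ++ g
    ≡⟨ cong (encInstr I ++_) (++-assoc (encSLP Q₁) (encSLP Q₂) g) ⟨
  encInstr I ++ (encSLP Q₁ ++ encSLP Q₂) ++ g
    ≡⟨ cong (λ v → encInstr I ++ v ++ g) (concatMap-++ encInstr Q₁ Q₂) ⟨
  encInstr I ++ encSLP (Q₁ ++ Q₂) ++ g
    ≡⟨ ++-assoc (encInstr I) (encSLP (Q₁ ++ Q₂)) g ⟨
  encSLP (I ∷ Q₁ ++ Q₂) ++ g ∎
  where open ≡-Reasoning

length-countingTape : ∀ l I Q₁ Q₂ g → length (countingTape l I Q₁ Q₂ g) ≡ length (encSLP (I ∷ Q₁ ++ Q₂)) + length g
length-countingTape l I Q₁ Q₂ g = begin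
  length (countingTape l I Q₁ Q₂ g)              ≡⟨ length-map erase (countingTape l I Q₁ Q₂ g) ⟨
  length (map erase (countingTape l I Q₁ Q₂ g))  ≡⟨ cong length (erase-countingTape l I Q₁ Q₂ g) ⟩
  length (encSLP (I ∷ Q₁ ++ Q₂) ++ g)            ≡⟨ length-++ (encSLP (I ∷ Q₁ ++ Q₂)) ⟩
  length (encSLP (I ∷ Q₁ ++ Q₂)) + length g      ∎
  where open ≡-Reasoning

countingTape-≤ : ∀ l l′ I {Q₁ Q₂ Q₁′ Q₂′ g g′} → Q₁ ++ Q₂ ≡ Q₁′ ++ Q₂′ → length g ≤ length g′ →
                 length (countingTape l I Q₁ Q₂ g) ≤ length (countingTape l′ I Q₁′ Q₂′ g′)
countingTape-≤ l l′ I {Q₁} {Q₂} {Q₁′} {Q₂′} {g} {g′} same g≤g′ = begin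
  length (countingTape l I Q₁ Q₂ g)           ≡⟨ length-countingTape l I Q₁ Q₂ g ⟩
  length (encSLP (I ∷ Q₁ ++ Q₂)) + length g    ≤⟨ +-mono-≤ (≤-reflexive (cong (λ Q → length (encSLP (I ∷ Q))) same)) g≤g′ ⟩
  length (encSLP (I ∷ Q₁′ ++ Q₂′)) + length g′ ≡⟨ length-countingTape l′ I Q₁′ Q₂′ g′ ⟨
  length (countingTape l′ I Q₁′ Q₂′ g′)        ∎
  where open ≤-Reasoning

length-∷ʳ : ∀ {A : Set} (xs : List A) x → length (xs ∷ʳ x) ≡ suc (length xs)
length-∷ʳ xs x = trans (length-++ xs) (+-comm (length xs) 1)

suffix-length : ∀ (A : List Symbol) t xs → length xs ≤ length (A ++ t ∷ xs)
suffix-length A t xs = ≤-trans (n≤1+n (length xs)) (length-++-≤ʳ (t ∷ xs) {A})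

module ++-Solver = Algebra.Solver.Monoid (++-monoid Symbol)

read-unary : ∀ q q′ → isHalt q ≡ false → Skips R q (bit true) → δ q (bit false) ≡ (q′ , bit false , R) →
             ∀ j A B → run machine (length (encNat j)) (at q A (bits (encNat j) ++ B)) ≡ at q′ (A ++ bits (encNat j)) B
read-unary q q′ h skip e zero    A B = step-right q A (bit false ∷ B) h e
read-unary q q′ h skip e (suc j) A B = begin
  run machine (length (encNat j)) (step machine (at q A (bit true ∷ bits (encNat j) ++ B)))
    ≡⟨ cong (run machine (length (encNat j))) (step-right q A (bit true ∷ bits (encNat j) ++ B) h skip) ⟩
  run machine (length (encNat j)) (at q (A ∷ʳ bit true) (bits (encNat j) ++ B))
    ≡⟨ read-unary q q′ h skip e j (A ∷ʳ bit true) B ⟩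
  at q′ ((A ∷ʳ bit true) ++ bits (encNat j)) B
    ≡⟨ cong (λ A′ → at q′ A′ B) (++-assoc A [ bit true ] (bits (encNat j))) ⟩
  at q′ (A ++ bit true ∷ bits (encNat j)) B ∎
  where open ≡-Reasoning

readOp-valid : ∀ o → δ (readOp (opBit₁ o)) (bit (opBit₂ o)) ≡ (readFirstIndex , bit (opBit₂ o) , R)
readOp-valid add = refl
readOp-valid sub = refl
readOp-valid mul = refl

length-encInstr : ∀ o j k → 1 + (1 + (length (encNat j) + length (encNat k))) ≡ length (encInstr (o , j , k))
length-encInstr o j k = sym (trans (cong length (encInstr-bits (o , j , k))) (cong (λ n → suc (suc n)) (length-++ (encNat j))))

copy-instr : ∀ q f → isHalt q ≡ false → (∀ b → δ q (bit b) ≡ (readOp b , f b , R)) → ∀ I A B →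
             at q A (tagged bit I ++ B) ⇒⟨ length (encInstr I) ⟩ at readNextInstr (A ++ tagged f I) B
copy-instr q f h read (o , j , k) A B =
  relax (≤-reflexive (length-encInstr o j k))
    (exactly 1 (step-right q A (tagged bit (o , j , k) ++ B) h (read b₁)) ▸
     exactly 1 (trans (step-right (readOp b₁) (A ∷ʳ f b₁) (bit b₂ ∷ bits (encNat j ++ encNat k) ++ B) refl (readOp-valid o))
                      (cong (at readFirstIndex A₂) operands)) ▸
     exactly (length (encNat j)) (read-unary readFirstIndex readSecondIndex refl refl refl j A₂ (bits (encNat k) ++ B)) ▸
     exactly (length (encNat k)) (trans (read-unary readSecondIndex readNextInstr refl refl refl k (A₂ ++ bits (encNat j)) B)
                                        (cong (λ A′ → at readNextInstr A′ B) copied)))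
  where
  open ++-Solver using (solve; _⊕_; _⊜_)
  b₁ = opBit₁ o
  b₂ = opBit₂ o
  A₂ = A ∷ʳ f b₁ ∷ʳ bit b₂
  operands : bits (encNat j ++ encNat k) ++ B ≡ bits (encNat j) ++ bits (encNat k) ++ B
  operands = trans (cong (_++ B) (map-++ bit (encNat j) (encNat k))) (++-assoc (bits (encNat j)) _ B)
  copied : (A₂ ++ bits (encNat j)) ++ bits (encNat k) ≡ A ++ tagged f (o , j , k)
  copied = trans (solve 5 (λ A x y J K → (((A ⊕ x) ⊕ y) ⊕ J) ⊕ K ⊜ A ⊕ (x ⊕ (y ⊕ (J ⊕ K)))) refl
                    A [ f b₁ ] [ bit b₂ ] (bits (encNat j)) (bits (encNat k)))
                 (cong (λ v → A ++ f b₁ ∷ bit b₂ ∷ v) (sym (map-++ bit (encNat j) (encNat k))))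

copy-SLP : ∀ Q A → at readNextInstr A (bits (encSLP Q)) ⇒⟨ length (encSLP Q) ⟩ at readNextInstr (A ++ taggedSLP lv4 Q) []
copy-SLP []      A = exactly 0 (cong (λ A′ → at readNextInstr A′ []) (sym (++-identityʳ A)))
copy-SLP (I ∷ Q) A =
  relax (≤-reflexive (sym (length-++ (encInstr I))))
    (exactly 0 (cong (at readNextInstr A) (bits-encSLP-∷ I Q)) ▸
     copy-instr readNextInstr (mark lv4) refl (λ _ → refl) I A (bits (encSLP Q)) ▸
     retarget (copy-SLP Q (A ++ tagged (mark lv4) I))
              (cong (λ A′ → at readNextInstr A′ []) (++-assoc A (tagged (mark lv4) I) (taggedSLP lv4 Q))))

copy-input : ∀ I Q → at readFirstInstr [] (bits (encSLP (I ∷ Q))) ⇒⟨ length (encSLP (I ∷ Q)) ⟩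
                     at readNextInstr (tagged (markFirst lv4) I ++ taggedSLP lv4 Q) []
copy-input I Q =
  relax (≤-reflexive (sym (length-++ (encInstr I))))
    (exactly 0 (cong (at readFirstInstr []) (bits-encSLP-∷ I Q)) ▸
     copy-instr readFirstInstr (markFirst lv4) refl (λ _ → refl) I [] (bits (encSLP Q)) ▸
     copy-SLP Q (tagged (markFirst lv4) I))

Rejects : Config machine → ℕ → Set
Rejects c k = HaltsWithin c k (true ∷ [])

rejects : ∀ q A B → isHalt q ≡ false → δ q (current B) ≡ rejectAction → Rejects (at q A B) 2
rejects q A B h e =
  _ , (exactly 1 (step-right q A B h e) ▸ exactly 1 (step-left reject A (bit true) (following B) refl refl)) , refl , refl

mutual
  readOp-rejects : ∀ b u A → parseOp b u ≡ nothing → Rejects (at (readOp b) A (bits u)) (length u + 2)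
  readOp-rejects false []          A _ = rejects (readOp false) A [] refl refl
  readOp-rejects true  []          A _ = rejects (readOp true) A [] refl refl
  readOp-rejects true  (true ∷ u)  A _ =
    relaxₕ (m≤n+m 2 (length (true ∷ u))) (rejects (readOp true) A (bits (true ∷ u)) refl refl)
  readOp-rejects false (false ∷ u) A e =
    exactly 1 (step-right (readOp false) A (bits (false ∷ u)) refl refl) ▸ₕ readFirstIndex-rejects add 0 u (A ∷ʳ bit false) e
  readOp-rejects false (true ∷ u)  A e =
    exactly 1 (step-right (readOp false) A (bits (true ∷ u)) refl refl) ▸ₕ readFirstIndex-rejects sub 0 u (A ∷ʳ bit true) e
  readOp-rejects true  (false ∷ u) A e =
    exactly 1 (step-right (readOp true) A (bits (false ∷ u)) refl refl) ▸ₕ readFirstIndex-rejects mul 0 u (A ∷ʳ bit false) e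

  readFirstIndex-rejects : ∀ o j u A → parseFirstIndex o j u ≡ nothing → Rejects (at readFirstIndex A (bits u)) (length u + 2)
  readFirstIndex-rejects o j []          A _ = rejects readFirstIndex A [] refl refl
  readFirstIndex-rejects o j (true ∷ u)  A e =
    exactly 1 (step-right readFirstIndex A (bits (true ∷ u)) refl refl) ▸ₕ readFirstIndex-rejects o (suc j) u (A ∷ʳ bit true) e
  readFirstIndex-rejects o j (false ∷ u) A e =
    exactly 1 (step-right readFirstIndex A (bits (false ∷ u)) refl refl) ▸ₕ readSecondIndex-rejects o j 0 u (A ∷ʳ bit false) e

  readSecondIndex-rejects : ∀ o j k u A → parseSecondIndex o j k u ≡ nothing →
                            Rejects (at readSecondIndex A (bits u)) (length u + 2)
  readSecondIndex-rejects o j k []          A _ = rejects readSecondIndex A [] refl refl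
  readSecondIndex-rejects o j k (true ∷ u)  A e =
    exactly 1 (step-right readSecondIndex A (bits (true ∷ u)) refl refl) ▸ₕ readSecondIndex-rejects o j (suc k) u (A ∷ʳ bit true) e
  readSecondIndex-rejects o j k (false ∷ u) A e with parse u in unparsable
  ... | nothing =
    exactly 1 (step-right readSecondIndex A (bits (false ∷ u)) refl refl) ▸ₕ readNextInstr-rejects u (A ∷ʳ bit false) unparsable

  readNextInstr-rejects : ∀ u A → parse u ≡ nothing → Rejects (at readNextInstr A (bits u)) (length u + 2)
  readNextInstr-rejects (b ∷ u) A e =
    exactly 1 (step-right readNextInstr A (bits (b ∷ u)) refl refl) ▸ₕ readOp-rejects b u (A ∷ʳ mark lv4 b) e

readFirstInstr-rejects : ∀ u → u ≡ [] ⊎ parse u ≡ nothing → Rejects (at readFirstInstr [] (bits u)) (length u + 2)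
readFirstInstr-rejects []      _        = rejects readFirstInstr [] [] refl refl
readFirstInstr-rejects (b ∷ u) (inj₂ e) =
  exactly 1 (step-right readFirstInstr [] (bits (b ∷ u)) refl refl) ▸ₕ readOp-rejects b u ([] ∷ʳ markFirst lv4 b) e

-- Pass l writes m ones and then trailer l.  gadgetPrefix encodes (sub,0,0), the opcode of
-- (sub,m+1,m) and the first 1 of m+1; trailer lv3 closes m and holds the opcode of mul and the
-- first two 1s of m+2; every other trailer just closes its numeral.
trailer : Level → List Bool
trailer lv3 = false ∷ true ∷ false ∷ true ∷ true ∷ []
trailer _   = false ∷ []

afterPass : Level → List Bool → ℕ → List Bool
afterPass l g q = g ++ replicate (suc q) true ++ trailer l

gadgetPrefix : List Bool
gadgetPrefix = false ∷ true ∷ false ∷ false ∷ false ∷ true ∷ true ∷ []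

gadgetBits : ℕ → List Bool
gadgetBits q = afterPass lv1 (afterPass lv2 (afterPass lv3 (afterPass lv4 gadgetPrefix q) q) q) q

module Bits-Solver = Algebra.Solver.Monoid (++-monoid Bool)

gadgetBits≡encSLP : ∀ q → gadgetBits q ≡ encSLP (negSquareGadget (suc q))
gadgetBits≡encSLP q =
  solve 4 (λ P R Z T → (((P ⊕ (R ⊕ Z)) ⊕ (R ⊕ (Z ⊕ T))) ⊕ (R ⊕ Z)) ⊕ (R ⊕ Z)
                     ⊜ P ⊕ (((R ⊕ Z) ⊕ (R ⊕ Z)) ⊕ (T ⊕ (((R ⊕ Z) ⊕ (R ⊕ Z)) ⊕ id))))
        refl gadgetPrefix (replicate (suc q) true) (false ∷ []) (true ∷ false ∷ true ∷ true ∷ [])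
  where open Bits-Solver

prefix-writes : Writes readNextInstr (bits gadgetPrefix) (seek lv4)
prefix-writes = _ , refl , refl , _ , refl , refl , _ , refl , refl , _ , refl , refl ,
                _ , refl , refl , _ , refl , refl , _ , refl , refl , refl

write-prefix : ∀ I Q → at readNextInstr (tagged (markFirst lv4) I ++ taggedSLP lv4 Q) [] ⇒⟨ 7 ⟩
                       at (seek lv4) (countingTape lv4 I Q [] gadgetPrefix) []
write-prefix I Q =
  retarget (exactly (length (bits gadgetPrefix))
                    (write-run {readNextInstr} {seek lv4} (bits gadgetPrefix) prefix-writes (tagged (markFirst lv4) I ++ taggedSLP lv4 Q)))
           (cong (λ T → at (seek lv4) T []) (++-assoc (tagged (markFirst lv4) I) (taggedSLP lv4 Q) (bits gadgetPrefix)))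

seek-skips-lower : ∀ {l} → Positive l → ∀ b → Skips L (seek l) (tag (lower l) b)
seek-skips-lower lv1⁺ b = refl
seek-skips-lower lv2⁺ b = refl
seek-skips-lower lv3⁺ b = refl
seek-skips-lower lv4⁺ b = refl

seek-finds-tag : ∀ {l} → Positive l → ∀ b → δ (seek l) (tag l b) ≡ (append l , tag (lower l) b , R)
seek-finds-tag lv1⁺ b = refl
seek-finds-tag lv2⁺ b = refl
seek-finds-tag lv3⁺ b = refl
seek-finds-tag lv4⁺ b = refl

seek-finds-first : ∀ {l} → Positive l → ∀ b → δ (seek l) (markFirst l b) ≡ (close l , markFirst (lower l) b , R)
seek-finds-first lv1⁺ b = refl
seek-finds-first lv2⁺ b = refl
seek-finds-first lv3⁺ b = refl
seek-finds-first lv4⁺ b = refl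

append-skips-tag : ∀ l l′ b → Skips R (append l) (tag l′ b)
append-skips-tag l lv0 b = refl
append-skips-tag l lv1 b = refl
append-skips-tag l lv2 b = refl
append-skips-tag l lv3 b = refl
append-skips-tag l lv4 b = refl

close-skips-tag : ∀ l l′ b → Skips R (close l) (tag l′ b)
close-skips-tag l lv0 b = refl
close-skips-tag l lv1 b = refl
close-skips-tag l lv2 b = refl
close-skips-tag l lv3 b = refl
close-skips-tag l lv4 b = refl

close-writes : ∀ {l} → Positive l → Writes (close l) (bits (true ∷ trailer l)) (seek (lower l))
close-writes lv1⁺ = _ , refl , refl , _ , refl , refl , refl
close-writes lv2⁺ = _ , refl , refl , _ , refl , refl , refl
close-writes lv3⁺ = _ , refl , refl , _ , refl , refl , _ , refl , refl , _ , refl , refl , _ , refl , refl , _ , refl , refl , refl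
close-writes lv4⁺ = _ , refl , refl , _ , refl , refl , refl

All-operands : ∀ {P : Symbol → Set} l → (∀ b → P (bit b)) → (∀ b → P (tag l b)) →
               ∀ u Q g → All P (bits u ++ taggedSLP l Q ++ bits g)
All-operands {P} l P-bit P-tag u Q g = All.++⁺ (All-bits u) (All.++⁺ (All.concat⁺ (All.map⁺ (universal All-tagged Q))) (All-bits g))
  where
  All-bits : ∀ u → All P (bits u)
  All-bits u = All.map⁺ (universal P-bit u)
  All-tagged : ∀ I → All P (tagged (tag l) I)
  All-tagged I = P-tag (leadBit I) ∷ All-bits (trailBits I)

sweep : ℕ → ℕ
sweep Λ = 2 * Λ + 3

round-trip-cost : ∀ x Λ v → x ≤ Λ → suc x + (1 + (x + suc v)) ≤ sweep Λ + v
round-trip-cost x Λ v x≤Λ = begin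
  suc x + (1 + (x + suc v))  ≡⟨ solve 2 (λ x v → con 1 :+ x :+ (con 1 :+ (x :+ (con 1 :+ v))) := con 2 :* x :+ con 3 :+ v) refl x v ⟩
  2 * x + 3 + v              ≤⟨ +-monoˡ-≤ v (+-monoˡ-≤ 3 (*-monoʳ-≤ 2 x≤Λ)) ⟩
  2 * Λ + 3 + v              ∎
  where open ≤-Reasoning
        open +-*-Solver

module Counting {l} (l⁺ : Positive l) (I : Instr) where

  tape : SLP → SLP → List Bool → List Symbol
  tape = countingTape l I

  seek-skips-operands : ∀ u Q g → All (Skips L (seek l)) (bits u ++ taggedSLP (lower l) Q ++ bits g)
  seek-skips-operands = All-operands (lower l) (λ _ → refl) (seek-skips-lower l⁺)

  iteration : ∀ Λ Q₁ J Q₂ g → length (tape (Q₁ ∷ʳ J) Q₂ g) ≤ Λ →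
              at (seek l) (tape (Q₁ ∷ʳ J) Q₂ g) [] ⇒⟨ sweep Λ ⟩ at (seek l) (tape Q₁ (J ∷ Q₂) (g ∷ʳ true)) []
  iteration Λ Q₁ J Q₂ g fits =
    relax cost
      (exactly 0 (cong (λ T → at (seek l) T []) before) ▸
       retarget (round-trip (seek l) (append l) [ bit true ] refl refl (seek-skips-operands (trailBits J) Q₂ g)
                            (seek-finds-tag l⁺ (leadBit J)) refl
                            (All-operands (lower l) (λ _ → refl) (append-skips-tag l (lower l)) (trailBits J) Q₂ g)
                            (seek l , refl , refl , refl) A)
                (cong (λ T → at (seek l) T []) after))
    where
    open ++-Solver using (solve; _⊕_; _⊜_) renaming (id to ε)
    A  = tagged (markFirst l) I ++ taggedSLP l Q₁
    rest = bits (trailBits J)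
    Sₗ = taggedSLP (lower l) Q₂
    xs = rest ++ Sₗ ++ bits g
    before : tape (Q₁ ∷ʳ J) Q₂ g ≡ A ++ tag l (leadBit J) ∷ xs
    before = trans (cong (λ S₁ → tagged (markFirst l) I ++ S₁ ++ Sₗ ++ bits g) (concatMap-++ (tagged (tag l)) Q₁ [ J ]))
                   (solve 5 (λ T S₁ X S₂ G → T ⊕ ((S₁ ⊕ (X ⊕ ε)) ⊕ (S₂ ⊕ G)) ⊜ (T ⊕ S₁) ⊕ (X ⊕ (S₂ ⊕ G))) refl
                      (tagged (markFirst l) I) (taggedSLP l Q₁) (tagged (tag l) J) Sₗ (bits g))
    after : A ++ tag (lower l) (leadBit J) ∷ xs ++ [ bit true ] ≡ tape Q₁ (J ∷ Q₂) (g ∷ʳ true)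
    after = trans (solve 7 (λ T S₁ t R₀ S₂ G W → (T ⊕ S₁) ⊕ (t ⊕ ((R₀ ⊕ (S₂ ⊕ G)) ⊕ W))
                                              ⊜ T ⊕ (S₁ ⊕ (((t ⊕ R₀) ⊕ S₂) ⊕ (G ⊕ W)))) refl
                     (tagged (markFirst l) I) (taggedSLP l Q₁) [ tag (lower l) (leadBit J) ] rest Sₗ (bits g) [ bit true ])
                  (cong (λ G → tagged (markFirst l) I ++ taggedSLP l Q₁ ++ (tagged (tag (lower l)) J ++ Sₗ) ++ G)
                        (sym (map-++ bit g [ true ])))
    cost : suc (length xs) + (1 + (length xs + 1)) ≤ sweep Λ
    cost = ≤-trans (round-trip-cost (length xs) Λ 0 (≤-trans (subst (λ T → length xs ≤ length T) (sym before) (suffix-length A _ xs)) fits))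
                   (≤-reflexive (+-identityʳ (sweep Λ)))

  -- Each iteration lowers the last instruction still tagged l, so the induction runs from the right.
  loop : ∀ Λ {Q₁} → Reverse Q₁ → ∀ Q₂ g → length (tape [] (Q₁ ++ Q₂) (g ++ replicate (length Q₁) true)) ≤ Λ →
         at (seek l) (tape Q₁ Q₂ g) [] ⇒⟨ length Q₁ * sweep Λ ⟩
         at (seek l) (tape [] (Q₁ ++ Q₂) (g ++ replicate (length Q₁) true)) []
  loop Λ [] Q₂ g fits = exactly 0 (cong (λ g′ → at (seek l) (tape [] Q₂ g′) []) (sym (++-identityʳ g)))
  loop Λ (Q₁ ∶ marked ∶ʳ J) Q₂ g fits =
    relax (≤-reflexive (cong (_* sweep Λ) (sym (length-∷ʳ Q₁ J))))
      (iteration Λ Q₁ J Q₂ g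
         (≤-trans (countingTape-≤ l l I {Q₁ ∷ʳ J} {Q₂} {[]} {(Q₁ ∷ʳ J) ++ Q₂} {g} refl (length-++-≤ˡ g)) fits) ▸
       retarget (loop Λ marked (J ∷ Q₂) (g ∷ʳ true) (subst (λ T → length T ≤ Λ) (sym same-end) fits))
                (cong (λ T → at (seek l) T []) same-end))
    where
    same-end : tape [] (Q₁ ++ J ∷ Q₂) ((g ∷ʳ true) ++ replicate (length Q₁) true)
             ≡ tape [] ((Q₁ ∷ʳ J) ++ Q₂) (g ++ replicate (length (Q₁ ∷ʳ J)) true)
    same-end = cong₂ (tape []) (sym (∷ʳ-++ Q₁ J Q₂))
                     (trans (∷ʳ-++ g true _) (cong (λ n → g ++ replicate n true) (sym (length-∷ʳ Q₁ J))))

  finish : ∀ Λ Q g → length (tape [] Q g) ≤ Λ →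
           at (seek l) (tape [] Q g) [] ⇒⟨ sweep Λ + length (trailer l) ⟩
           at (seek (lower l)) (countingTape (lower l) I Q [] (g ++ true ∷ trailer l)) []
  finish Λ Q g fits =
    relax cost
      (retarget (round-trip (seek l) (close l) (bits (true ∷ trailer l)) refl refl (seek-skips-operands (trailBits I) Q g)
                            (seek-finds-first l⁺ (leadBit I)) refl
                            (All-operands (lower l) (λ _ → refl) (close-skips-tag l (lower l)) (trailBits I) Q g)
                            (close-writes l⁺) [])
                (cong (λ T → at (seek (lower l)) (markFirst (lower l) (leadBit I) ∷ T) []) output))
    where
    xs = bits (trailBits I) ++ taggedSLP (lower l) Q ++ bits g
    output : xs ++ bits (true ∷ trailer l) ≡ bits (trailBits I) ++ taggedSLP (lower l) Q ++ bits (g ++ true ∷ trailer l)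
    output = trans (++-assoc (bits (trailBits I)) _ _)
                   (cong (bits (trailBits I) ++_) (trans (++-assoc (taggedSLP (lower l) Q) (bits g) _)
                                                         (cong (taggedSLP (lower l) Q ++_) (sym (map-++ bit g (true ∷ trailer l))))))
    cost : suc (length xs) + (1 + (length xs + length (bits (true ∷ trailer l)))) ≤ sweep Λ + length (trailer l)
    cost = ≤-trans (round-trip-cost (length xs) Λ (length (bits (trailer l))) (≤-trans (n≤1+n (length xs)) fits))
                   (≤-reflexive (cong (sweep Λ +_) (length-map bit (trailer l))))

  pass : ∀ Λ Q g → length (countingTape (lower l) I Q [] (afterPass l g (length Q))) ≤ Λ →
         at (seek l) (tape Q [] g) [] ⇒⟨ suc (length Q) * sweep Λ + length (trailer l) ⟩
         at (seek (lower l)) (countingTape (lower l) I Q [] (afterPass l g (length Q))) []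
  pass Λ Q g fits =
    relax (≤-reflexive cost)
      (retarget (loop Λ (reverseView Q) [] g (subst (λ Q′ → length (tape [] Q′ g′) ≤ Λ) (sym (++-identityʳ Q)) finish-fits))
                (cong (λ Q′ → at (seek l) (tape [] Q′ g′) []) (++-identityʳ Q)) ▸
       retarget (finish Λ Q g′ finish-fits)
                (cong (λ g″ → at (seek (lower l)) (countingTape (lower l) I Q [] g″) []) output))
    where
    g′ = g ++ replicate (length Q) true
    output : g′ ++ true ∷ trailer l ≡ afterPass l g (length Q)
    output = trans (++-assoc g _ _) (cong (g ++_) (sym (replicate-suc-++ (length Q) true (trailer l))))
    finish-fits : length (tape [] Q g′) ≤ Λ
    finish-fits = ≤-trans (countingTape-≤ l (lower l) I {[]} {Q} {Q} {[]} {g′} (sym (++-identityʳ Q))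
                                         (subst (λ h → length g′ ≤ length h) output (length-++-≤ˡ g′))) fits
    cost : length Q * sweep Λ + (sweep Λ + length (trailer l)) ≡ suc (length Q) * sweep Λ + length (trailer l)
    cost = solve 3 (λ q k t → q :* k :+ (k :+ t) := (con 1 :+ q) :* k :+ t) refl (length Q) (sweep Λ) (length (trailer l))
      where open +-*-Solver

halts-after-passes : ∀ I Q g → HaltsWithin (at (seek lv0) (countingTape lv0 I Q [] g) [])
                                           (length (countingTape lv0 I Q [] g) + 1) (encSLP (I ∷ Q) ++ g)
halts-after-passes I Q g =
  _ , (exactly (suc (length xs)) (scan-left (seek lv0) {B = []} refl refl (All-operands lv0 (λ _ → refl) (λ _ → refl) (trailBits I) Q g)
                                            [] (markFirst lv0 (leadBit I))) ▸
       exactly 1 (step-stay (seek lv0) [] (markFirst lv0 (leadBit I) ∷ xs ++ [ void ]) refl refl)) ,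
  refl , trans (cong (λ T → readBits machine (map encodeSymbol (T ++ [ void ]))) unmarked) (readBits-bits (encSLP (I ∷ Q) ++ g))
  where
  xs = bits (trailBits I) ++ taggedSLP lv0 Q ++ bits g
  unmarked : bit (leadBit I) ∷ xs ≡ bits (encSLP (I ∷ Q) ++ g)
  unmarked = sym (begin
    bits ((encInstr I ++ encSLP Q) ++ g)                ≡⟨ cong bits (++-assoc (encInstr I) (encSLP Q) g) ⟩
    bits (encInstr I ++ encSLP Q ++ g)                  ≡⟨ map-++ bit (encInstr I) _ ⟩
    bits (encInstr I) ++ bits (encSLP Q ++ g)           ≡⟨ cong₂ _++_ (bits-encInstr I) (map-++ bit (encSLP Q) g) ⟩
    tagged bit I ++ bits (encSLP Q) ++ bits g           ≡⟨ cong (λ T → tagged bit I ++ T ++ bits g) (bits-encSLP Q) ⟩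
    tagged bit I ++ taggedSLP lv0 Q ++ bits g           ∎)
    where open ≡-Reasoning

-- Running time

length-afterPass : ∀ l g q → length (afterPass l g q) ≡ length g + (suc q + length (trailer l))
length-afterPass l g q =
  trans (length-++ g) (cong (length g +_) (trans (length-++ (replicate (suc q) true))
                                                 (cong (_+ length (trailer l)) (length-replicate (suc q)))))

length-gadgetBits : ∀ q → length (gadgetBits q) ≡ 4 * q + 19
length-gadgetBits q = begin
  length (gadgetBits q)
    ≡⟨ length-afterPass lv1 g₁ q ⟩
  length g₁ + (suc q + 1)
    ≡⟨ cong (_+ (suc q + 1)) (length-afterPass lv2 g₂ q) ⟩
  length g₂ + (suc q + 1) + (suc q + 1)
    ≡⟨ cong (λ n → n + (suc q + 1) + (suc q + 1)) (length-afterPass lv3 g₃ q) ⟩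
  length g₃ + (suc q + 5) + (suc q + 1) + (suc q + 1)
    ≡⟨ cong (λ n → n + (suc q + 5) + (suc q + 1) + (suc q + 1)) (length-afterPass lv4 gadgetPrefix q) ⟩
  7 + (suc q + 1) + (suc q + 5) + (suc q + 1) + (suc q + 1)
    ≡⟨ solve 1 (λ q → con 7 :+ (con 1 :+ q :+ con 1) :+ (con 1 :+ q :+ con 5) :+ (con 1 :+ q :+ con 1) :+ (con 1 :+ q :+ con 1)
                   := con 4 :* q :+ con 19) refl q ⟩
  4 * q + 19
    ∎
  where
  open ≡-Reasoning
  open +-*-Solver
  g₃ = afterPass lv4 gadgetPrefix q
  g₂ = afterPass lv3 g₃ q
  g₁ = afterPass lv2 g₂ q

-- Copying the input, writing gadgetPrefix, the four passes and the final sweep to the left end.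
acceptTime : ℕ → ℕ → ℕ → ℕ
acceptTime n q Λ = n + (7 + (pass 1 + (pass 5 + (pass 1 + pass 1)))) + (Λ + 1)
  where
  pass : ℕ → ℕ
  pass t = suc q * sweep Λ + t

accepts : ∀ I Q → HaltsWithin (at readFirstInstr [] (bits (encSLP (I ∷ Q))))
                              (acceptTime (length (encSLP (I ∷ Q))) (length Q) (length (countingTape lv0 I Q [] (gadgetBits (length Q)))))
                              (encSLP (I ∷ Q) ++ gadgetBits (length Q))
accepts I Q =
  (copy-input I Q ▸
  write-prefix I Q ▸
  Counting.pass lv4⁺ I Λ Q g₄ (fits lv3 g₃ (≤-trans (length-++-≤ˡ g₃) (≤-trans (length-++-≤ˡ g₂) (length-++-≤ˡ g₁)))) ▸
  Counting.pass lv3⁺ I Λ Q g₃ (fits lv2 g₂ (≤-trans (length-++-≤ˡ g₂) (length-++-≤ˡ g₁))) ▸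
  Counting.pass lv2⁺ I Λ Q g₂ (fits lv1 g₁ (length-++-≤ˡ g₁)) ▸
  Counting.pass lv1⁺ I Λ Q g₁ (fits lv0 g₀ (≤-reflexive refl))) ▸ₕ
  halts-after-passes I Q g₀
  where
  q  = length Q
  g₄ = gadgetPrefix
  g₃ = afterPass lv4 g₄ q
  g₂ = afterPass lv3 g₃ q
  g₁ = afterPass lv2 g₂ q
  g₀ = afterPass lv1 g₁ q
  Λ  = length (countingTape lv0 I Q [] g₀)
  fits : ∀ l g → length g ≤ length g₀ → length (countingTape l I Q [] g) ≤ Λ
  fits l g g≤g₀ = countingTape-≤ l lv0 I {Q} {[]} {Q} {[]} {g} {g₀} refl g≤g₀

timeBound : ℕ → ℕ
timeBound n = 200 * n ^ 2 + 200

n≤n*n : ∀ n → n ≤ n * n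
n≤n*n zero    = z≤n
n≤n*n (suc n) = m≤m*n (suc n) (suc n)

acceptTime-bound : ∀ n q → suc q ≤ n → acceptTime n q (n + (4 * q + 19)) ≤ timeBound n
acceptTime-bound n q m≤n = begin
  acceptTime n q (n + (4 * q + 19))
    ≡⟨ solve 2 (λ n q → n :+ (con 7 :+ ((m q :* K n q :+ con 1) :+ ((m q :* K n q :+ con 5) :+ ((m q :* K n q :+ con 1) :+
                          (m q :* K n q :+ con 1))))) :+ (n :+ (con 4 :* q :+ con 19) :+ con 1)
                := con 8 :* (n :* m q) :+ con 32 :* (m q :* m q) :+ con 136 :* m q :+ con 2 :* n :+ con 31) refl n q ⟩
  8 * (n * suc q) + 32 * (suc q * suc q) + 136 * suc q + 2 * n + 31
    ≤⟨ +-monoˡ-≤ 31 (+-monoˡ-≤ (2 * n)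
         (+-mono-≤ (+-mono-≤ (*-monoʳ-≤ 8 (*-monoʳ-≤ n m≤n)) (*-monoʳ-≤ 32 (*-mono-≤ m≤n m≤n))) (*-monoʳ-≤ 136 m≤n))) ⟩
  8 * (n * n) + 32 * (n * n) + 136 * n + 2 * n + 31
    ≡⟨ solve 1 (λ n → con 8 :* (n :* n) :+ con 32 :* (n :* n) :+ con 136 :* n :+ con 2 :* n :+ con 31
                   := con 40 :* (n :* n) :+ con 138 :* n :+ con 31) refl n ⟩
  40 * (n * n) + 138 * n + 31
    ≤⟨ +-mono-≤ (+-monoʳ-≤ (40 * (n * n)) (*-monoʳ-≤ 138 (n≤n*n n))) (m≤m+n 31 169) ⟩
  40 * (n * n) + 138 * (n * n) + 200
    ≡⟨ cong (_+ 200) (solve 1 (λ n → con 40 :* (n :* n) :+ con 138 :* (n :* n) := con 178 :* (n :* n)) refl n) ⟩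
  178 * (n * n) + 200
    ≤⟨ +-monoˡ-≤ 200 (*-monoˡ-≤ (n * n) (m≤m+n 178 22)) ⟩
  200 * (n * n) + 200
    ≡⟨ cong (λ k → 200 * k + 200) (cong (n *_) (sym (*-identityʳ n))) ⟩
  200 * n ^ 2 + 200 ∎
  where
  open ≤-Reasoning
  open +-*-Solver
  m : ∀ {k} → Polynomial k → Polynomial k
  m q = con 1 :+ q
  K : ∀ {k} → Polynomial k → Polynomial k → Polynomial k
  K n q = con 2 :* (n :+ (con 4 :* q :+ con 19)) :+ con 3

length≤length-encSLP : ∀ P → length P ≤ length (encSLP P)
length≤length-encSLP []      = z≤n
length≤length-encSLP (I ∷ Q) =
  subst (λ e → suc (length Q) ≤ length (e ++ encSLP Q)) (sym (encInstr-bits I))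
        (s≤s (≤-trans (length≤length-encSLP Q) (length-++-≤ʳ (encSLP Q) {trailBits I})))

n+2≤timeBound : ∀ n → n + 2 ≤ timeBound n
n+2≤timeBound n = +-mono-≤ (≤-trans (subst (n ≤_) (cong (n *_) (sym (*-identityʳ n))) (n≤n*n n)) (m≤n*m (n ^ 2) 200)) (m≤m+n 2 198)

reduction : List Bool → List Bool
reduction w with parse w
... | just P@(_ ∷ _) = encSLP (appendNegSquare P)
... | _              = true ∷ []

rejection-correct : ∀ {w} → ¬ EquSLP w → EquSLP w ⇔ TwoSoSSLP (true ∷ [])
rejection-correct {w} ¬equ = mk⇔ (λ equ → contradiction equ ¬equ) from
  where
  from : TwoSoSSLP (true ∷ []) → EquSLP w
  from (P , _ , e , _) = contradiction e (encSLP≢[true] P)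

reduction-correct : ∀ w → EquSLP w ⇔ TwoSoSSLP (reduction w)
reduction-correct w with parse w in parsed
... | nothing = rejection-correct unparsable
  where
  unparsable : ¬ EquSLP w
  unparsable (P , _ , refl , _) = contradiction (trans (sym parsed) (parse-encSLP P)) λ ()
... | just [] = rejection-correct empty
  where
  empty : ¬ EquSLP w
  empty (P , wf , e , N≡0) =
    contradiction (Equivalence.to (encSLP-member⇔ (_≡ 0ℤ) []) (P , wf , trans e (sym (parse-sound w parsed)) , N≡0)) λ ()
... | just P@(_ ∷ _) =
  subst (λ v → EquSLP v ⇔ TwoSoSSLP (encSLP (appendNegSquare P))) (parse-sound w parsed)
    (⇔.trans (encSLP-member⇔ (_≡ 0ℤ) P)
      (⇔.trans (appendNegSquare-correct P) (⇔.sym (encSLP-member⇔ IsSumOfTwoSquares (appendNegSquare P)))))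

accepted : ∀ I Q → HaltsWith machine (encSLP (I ∷ Q)) (timeBound (length (encSLP (I ∷ Q)))) (encSLP (appendNegSquare (I ∷ Q)))
accepted I Q =
  subst₂ (λ c out → Halted (run machine (timeBound n) c) out) (sym (initConfig≡at (encSLP (I ∷ Q)))) output
    (halted-after (timeBound n) (accepts I Q) (subst (λ Λ → acceptTime n q Λ ≤ timeBound n) (sym tape-length)
                                                     (acceptTime-bound n q (length≤length-encSLP (I ∷ Q)))))
  where
  n = length (encSLP (I ∷ Q))
  q = length Q
  tape-length : length (countingTape lv0 I Q [] (gadgetBits q)) ≡ n + (4 * q + 19)
  tape-length = trans (length-countingTape lv0 I Q [] (gadgetBits q))
                      (cong₂ _+_ (cong (λ Q′ → length (encSLP (I ∷ Q′))) (++-identityʳ Q)) (length-gadgetBits q))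
  output : encSLP (I ∷ Q) ++ gadgetBits q ≡ encSLP (appendNegSquare (I ∷ Q))
  output = trans (cong (encSLP (I ∷ Q) ++_) (gadgetBits≡encSLP q)) (sym (concatMap-++ encInstr (I ∷ Q) (negSquareGadget (suc q))))

rejected : ∀ w → w ≡ [] ⊎ parse w ≡ nothing → HaltsWith machine w (timeBound (length w)) (true ∷ [])
rejected w r =
  subst (λ c → Halted (run machine (timeBound (length w)) c) (true ∷ [])) (sym (initConfig≡at w))
    (halted-after (timeBound (length w)) (readFirstInstr-rejects w r) (n+2≤timeBound (length w)))

machine-computes : ∀ w → HaltsWith machine w (timeBound (length w)) (reduction w)
machine-computes w with parse w in parsed
... | nothing       = rejected w (inj₂ parsed)
... | just []       = rejected w (inj₁ (sym (parse-sound w parsed)))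
... | just (I ∷ Q)  = subst (λ v → HaltsWith machine v (timeBound (length v)) (encSLP (appendNegSquare (I ∷ Q))))
                            (parse-sound w parsed) (accepted I Q)

mainTheorem14 : EquSLP ≤P TwoSoSSLP
mainTheorem14 = machine , 200 , 2 , λ w → reduction w , timeBound (length w) , ≤-refl , machine-computes w , reduction-correct w
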